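{- Let $(X,\le,c)$ be a finite strongly involution poset. Define $h_+:\mathcal{W}_+(X,\mathbf{2})\to\mathcal{B}_{w_+}(X)$ by $h_+(A)=\langle W\cap A^{ -1}(P)\mid W\cap A^{ -1}(N)\rangle$ where $W=\mathrm{Core}_{w_+}(A)$, and $h_-:\mathcal{W}_-(X,\mathbf{2})\to\mathcal{B}_{w_- }(X)$ by $h_-(A)=\langle W\cap A^{ -1}(P)\mid W\cap A^{ -1}(N)\rangle$ where $W=\mathrm{Core}_{w_- }(A)$. Then these maps are well defined (take values in the indicated sets) and $h_+$ and $h_-$ are bijective.
   Context: A strongly involution poset is a poset $(X,\le)$ with $c:X\to X$, $x\mapsto x^c$, such that $(x^c)^c=x$, $x\le y\Rightarrow y^c\le x^c$, and $x^c\ne x$ for all $x$ (when $|X|\ge2$). For $Z\subseteq X$: $Z^c=\{z^c:z\in Z\}$, $\uparrow Z=\{x:\exists z\in Z,\ z\le x\}$, $\downarrow Z=\{x:\exists z\in Z,\ x\le z\}$, $\mathrm{Min}(Z),\mathrm{Max}(Z)$ the minimal/maximal elements. $\mathbf{2}$ is the chain $N<P$. $\mathcal{W}_+(X,\mathbf{2})$ (resp. $\mathcal{W}_-(X,\mathbf{2})$) is the set of maps $A:X\to\mathbf{2}$ such that $A^{ -1}(P)$ is an up-set, $A^{ -1}(N)$ is a down-set, and $A^{ -1}(N)^c\subseteq A^{ -1}(P)$ (resp. $A^{ -1}(P)^c\subseteq A^{ -1}(N)$). For such $A$, $N(A)=\mathrm{Min}(A^{ -1}(P))\cup\mathrm{Max}(A^{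 -1}(N))$, $\mathrm{Core}_{w_+}(A)=N(A)\setminus[\mathrm{Max}(A^{ -1}(N))]^c$ and $\mathrm{Core}_{w_- }(A)=N(A)\setminus[\mathrm{Min}(A^{ -1}(P))]^c$. A $w_+$-basis for $X$ is an ordered pair $\langle Y_+\mid Y_-\rangle$ of disjoint antichains of $X$ with (B1+) $(\downarrow Y_+)\cap Y_-^c=\emptyset$, (B2+) $(\uparrow Y_+\cup\uparrow Y_-^c)\cap\downarrow Y_-=\emptyset$, (B3+) $X=(\uparrow Y_+\cup\uparrow Y_-^c)\cup\downarrow Y_-$. A $w_-$-basis is an ordered pair $\langle Y_+\mid Y_-\rangle$ of disjoint antichains with (B1-) $(\uparrow Y_-)\cap Y_+^c=\emptyset$, (B2-) $(\downarrow Y_-\cup\downarrow Y_+^c)\cap\uparrow Y_+=\emptyset$, (B3-) $X=(\downarrow Y_-\cup\downarrow Y_+^c)\cup\uparrow Y_+$. Two bases are equal iff both components are equal. $\mathcal{B}_{w_+}(X)$, $\mathcal{B}_{w_- }(X)$ denote the sets of $w_+$-bases and $w_-$-bases. -}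

module Defs where

-- Maps A : X → 2 are represented by the subset A⁻¹(P) (a Subset n = Vec Bool n);
-- A⁻¹(N) is its complement ∁ A.

open import Level using (0ℓ)
open import Data.Nat using (ℕ; _≤_)
open import Data.Fin using (Fin; _≟_)
open import Data.Fin.Subset using (Subset; _∈_; _∉_; _∩_; _∪_; ∁; _⊆_)
open import Data.Fin.Subset.Properties using (_∈?_)
open import Data.Fin.Properties using (any?; all?)
open import Data.Vec using (tabulate)
open import Data.Product using (Σ; ∃; _×_; _,_)
open import Data.Sum using (_⊎_)
open import Data.Empty using (⊥)
open import Relation.Nullary using (¬_; does)
open import Relation.Nullary.Decidable using (_×-dec_; _→-dec_)
open import Relation.Binary using (Decidable; IsPartialOrder)
open import Relation.Binary.PropositionalEquality using (_≡_; _≢_)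

record SIPoset (n : ℕ) : Set₁ where
  field
    _≼_ : Fin n → Fin n → Set
    _≼?_ : Decidable _≼_
    isPartialOrder : IsPartialOrder _≡_ _≼_
    c : Fin n → Fin n
    c-invol : ∀ x → c (c x) ≡ x
    c-anti : ∀ {x y} → x ≼ y → c y ≼ c x
    c-nofix : 2 ≤ n → ∀ x → c x ≢ x

module _ {n : ℕ} (X : SIPoset n) where
  open SIPoset X

  -- Z^c = { z^c : z ∈ Z }
  img : Subset n → Subset n
  img Z = tabulate (λ x → does (any? (λ z → (z ∈? Z) ×-dec (c z ≟ x))))

  Up : Subset n → Fin n → Set
  Up Z x = ∃ λ z → z ∈ Z × z ≼ x

  Down : Subset n → Fin n → Set
  Down Z x = ∃ λ z → z ∈ Z × x ≼ z

  Min : Subset n → Subset n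
  Min Z = tabulate (λ x → does ((x ∈? Z) ×-dec all? (λ y → (y ∈? Z) →-dec ((y ≼? x) →-dec (y ≟ x)))))

  Max : Subset n → Subset n
  Max Z = tabulate (λ x → does ((x ∈? Z) ×-dec all? (λ y → (y ∈? Z) →-dec ((x ≼? y) →-dec (x ≟ y)))))

  IsUpSet : Subset n → Set
  IsUpSet Z = ∀ x y → x ∈ Z → x ≼ y → y ∈ Z

  IsDownSet : Subset n → Set
  IsDownSet Z = ∀ x y → y ∈ Z → x ≼ y → x ∈ Z

  IsAntichain : Subset n → Set
  IsAntichain Z = ∀ x y → x ∈ Z → y ∈ Z → x ≼ y → x ≡ y

  Disjoint : Subset n → Subset n → Set
  Disjoint Y Z = ∀ x → x ∈ Y → x ∉ Z

  IsW+ : Subset n → Set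
  IsW+ A = IsUpSet A × IsDownSet (∁ A) × (img (∁ A) ⊆ A)

  IsW- : Subset n → Set
  IsW- A = IsUpSet A × IsDownSet (∁ A) × (img A ⊆ ∁ A)

  NA : Subset n → Subset n
  NA A = Min A ∪ Max (∁ A)

  Core+ : Subset n → Subset n
  Core+ A = NA A ∩ ∁ (img (Max (∁ A)))

  Core- : Subset n → Subset n
  Core- A = NA A ∩ ∁ (img (Min A))

  Basis : Set
  Basis = Subset n × Subset n

  IsBasis+ : Basis → Set
  IsBasis+ (Y₊ , Y₋) =
    IsAntichain Y₊ × IsAntichain Y₋ × Disjoint Y₊ Y₋
    × (∀ x → Down Y₊ x → x ∈ img Y₋ → ⊥)
    × (∀ x → (Up Y₊ x ⊎ Up (img Y₋) x) → Down Y₋ x → ⊥)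
    × (∀ x → (Up Y₊ x ⊎ Up (img Y₋) x) ⊎ Down Y₋ x)

  IsBasis- : Basis → Set
  IsBasis- (Y₊ , Y₋) =
    IsAntichain Y₊ × IsAntichain Y₋ × Disjoint Y₊ Y₋
    × (∀ x → Up Y₋ x → x ∈ img Y₊ → ⊥)
    × (∀ x → (Down Y₋ x ⊎ Down (img Y₊) x) → Up Y₊ x → ⊥)
    × (∀ x → (Down Y₋ x ⊎ Down (img Y₊) x) ⊎ Up Y₊ x)

  h+ : Subset n → Basis
  h+ A = (Core+ A ∩ A , Core+ A ∩ ∁ A)

  h- : Subset n → Basis
  h- A = (Core- A ∩ A , Core- A ∩ ∁ A)

-- f : S → T restricted to {a | IsS a} is well defined into {b | IsT b} and bijective
-- (equality of maps = equality of subsets; equality of bases = componentwise equality).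
WellDefBij : {S T : Set} → (S → Set) → (T → Set) → (S → T) → Set
WellDefBij {S} {T} IsS IsT f =
  (∀ a → IsS a → IsT (f a))
  × (∀ a b → IsS a → IsS b → f a ≡ f b → a ≡ b)
  × (∀ t → IsT t → Σ S λ a → IsS a × f a ≡ t)

-- A map A ∈ 𝒲₊ is determined by the down-set ∁ A, hence by its antichain of maximal elements
-- Max (∁ A), which is the second component of h₊ A; the first component is then forced to be
-- the part of Min A outside the involutive image of Max (∁ A).  Conversely a w₊-basis ⟨Y₊ ∣ Y₋⟩
-- is the image of A = ∁ (↓ Y₋): (B2+) and (B3+) say that A = ↑Y₊ ∪ ↑Y₋ᶜ, and (B1+) makes the
-- elements of Y₊ minimal in A.  The statement for h₋ is the statement for h₊ in the opposite
-- poset, applied to ∁ A and with the two components of a basis swapped.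
module Submission where

open import Defs
open import Data.Nat using (ℕ)
open import Data.Fin using (Fin; _≟_)
open import Data.Fin.Subset using (Subset; _∈_; _∉_; _∩_; ∁; _⊆_)
open import Data.Fin.Subset.Properties
  using (_∈?_; ⊆-antisym; ∪-comm; x∈p∩q⁺; x∈p∩q⁻; x∈p∪q⁺; x∈p∪q⁻; x∈∁p⇒x∉p; x∉p⇒x∈∁p; x∈p⇒x∉∁p; x∉∁p⇒x∈p)
open import Data.Fin.Properties using (any?; all?)
open import Data.Fin.Induction using (po-noetherian)
open import Data.Vec using (tabulate)
open import Data.Vec.Properties using ([]=⇒lookup; lookup⇒[]=; lookup∘tabulate)
open import Data.Product using (Σ; ∃; _×_; _,_; proj₁; proj₂; swap)
open import Data.Sum using (_⊎_; inj₁; inj₂)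
open import Data.Empty using (⊥; ⊥-elim)
open import Function using (_∘_; flip)
open import Induction.WellFounded using (Acc; acc)
open import Relation.Nullary using (Dec; does; yes; no)
open import Relation.Nullary.Decidable using (dec-true; decidable-stable; ¬?; _×-dec_; _→-dec_)
open import Relation.Binary using (IsPartialOrder)
import Relation.Binary.Construct.Flip.EqAndOrd as Flip
open import Relation.Binary.PropositionalEquality using (_≡_; refl; sym; trans; cong; cong₂; subst; module ≡-Reasoning)

WellDefBij-transport :
  {S T : Set} {IsS IsS′ : S → Set} {IsT IsT′ : T → Set} {f g : S → T}
  (φ : S → S) (ψ : T → T) → (∀ a → φ (φ a) ≡ a) → (∀ t → ψ (ψ t) ≡ t) →
  (∀ a → IsS′ a → IsS (φ a)) → (∀ a → IsS a → IsS′ (φ a)) →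
  (∀ t → IsT′ t → IsT (ψ t)) → (∀ t → IsT t → IsT′ (ψ t)) →
  (∀ a → f (φ a) ≡ ψ (g a)) →
  WellDefBij IsS IsT f → WellDefBij IsS′ IsT′ g
WellDefBij-transport {IsS′ = IsS′} {IsT′ = IsT′} {f = f} {g}
  φ ψ φφ ψψ S′→S S→S′ T′→T T→T′ f∘φ≡ψ∘g (wd , inj , surj) = wd′ , inj′ , surj′
  where
  g≡ψ∘f∘φ : ∀ a → g a ≡ ψ (f (φ a))
  g≡ψ∘f∘φ a = trans (sym (ψψ (g a))) (cong ψ (sym (f∘φ≡ψ∘g a)))

  wd′ : ∀ a → IsS′ a → IsT′ (g a)
  wd′ a s = subst IsT′ (sym (g≡ψ∘f∘φ a)) (T→T′ _ (wd (φ a) (S′→S a s)))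

  inj′ : ∀ a b → IsS′ a → IsS′ b → g a ≡ g b → a ≡ b
  inj′ a b sa sb e = trans (sym (φφ a)) (trans (cong φ φa≡φb) (φφ b))
    where
    φa≡φb : φ a ≡ φ b
    φa≡φb = inj (φ a) (φ b) (S′→S a sa) (S′→S b sb)
              (trans (f∘φ≡ψ∘g a) (trans (cong ψ e) (sym (f∘φ≡ψ∘g b))))

  surj′ : ∀ t → IsT′ t → Σ _ λ a → IsS′ a × g a ≡ t
  surj′ t t′ with surj (ψ t) (T′→T t t′)
  ... | a , s , fa≡ψt = φ a , S→S′ a s ,
        trans (g≡ψ∘f∘φ (φ a)) (trans (cong (ψ ∘ f) (φφ a)) (trans (cong ψ fa≡ψt) (ψψ t)))

∁-involutive : ∀ {n} (p : Subset n) → ∁ (∁ p) ≡ p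
∁-involutive p = ⊆-antisym (x∉∁p⇒x∈p ∘ x∈∁p⇒x∉p) (x∉p⇒x∈∁p ∘ x∈p⇒x∉∁p)

∁-injective : ∀ {n} {p q : Subset n} → ∁ p ≡ ∁ q → p ≡ q
∁-injective {p = p} {q} e = trans (sym (∁-involutive p)) (trans (cong ∁ e) (∁-involutive q))

module _ {n} {P : Fin n → Set} (P? : ∀ x → Dec (P x)) where

  ∈-tabulate-does⁺ : ∀ {x} → P x → x ∈ tabulate (does ∘ P?)
  ∈-tabulate-does⁺ {x} px =
    lookup⇒[]= x _ (trans (lookup∘tabulate (does ∘ P?) x) (dec-true (P? x) px))

  ∈-tabulate-does⁻ : ∀ {x} → x ∈ tabulate (does ∘ P?) → P x
  ∈-tabulate-does⁻ {x} x∈ with P? x | trans (sym (lookup∘tabulate (does ∘ P?) x)) ([]=⇒lookup x∈)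
  ... | yes px | _ = px
  ... | no _   | ()

module Order {n : ℕ} (X : SIPoset n) where
  open SIPoset X
  open IsPartialOrder isPartialOrder using () renaming (refl to ≼-refl; trans to ≼-trans; antisym to ≼-antisym)
  open import Relation.Binary.Construct.NonStrictToStrict _≡_ _≼_ using () renaming (_<_ to _≺_)

  Minimal Maximal : Subset n → Fin n → Set
  Minimal Z x = x ∈ Z × (∀ y → y ∈ Z → y ≼ x → y ≡ x)
  Maximal Z x = x ∈ Z × (∀ y → y ∈ Z → x ≼ y → x ≡ y)

  Minimal? : ∀ Z x → Dec (Minimal Z x)
  Minimal? Z x = (x ∈? Z) ×-dec all? (λ y → (y ∈? Z) →-dec ((y ≼? x) →-dec (y ≟ x)))
  Maximal? : ∀ Z x → Dec (Maximal Z x)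
  Maximal? Z x = (x ∈? Z) ×-dec all? (λ y → (y ∈? Z) →-dec ((x ≼? y) →-dec (x ≟ y)))

  Image? : ∀ Z x → Dec (∃ λ z → z ∈ Z × c z ≡ x)
  Image? Z x = any? (λ z → (z ∈? Z) ×-dec (c z ≟ x))

  Down? : ∀ Z x → Dec (Down X Z x)
  Down? Z x = any? (λ z → (z ∈? Z) ×-dec (x ≼? z))

  ∈Min⁺ : ∀ {Z x} → Minimal Z x → x ∈ Min X Z
  ∈Min⁺ {Z} = ∈-tabulate-does⁺ (Minimal? Z)

  ∈Min⁻ : ∀ {Z x} → x ∈ Min X Z → Minimal Z x
  ∈Min⁻ {Z} = ∈-tabulate-does⁻ (Minimal? Z)

  ∈Max⁺ : ∀ {Z x} → Maximal Z x → x ∈ Max X Z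
  ∈Max⁺ {Z} = ∈-tabulate-does⁺ (Maximal? Z)

  ∈Max⁻ : ∀ {Z x} → x ∈ Max X Z → Maximal Z x
  ∈Max⁻ {Z} = ∈-tabulate-does⁻ (Maximal? Z)

  ∈img⁺ : ∀ {Z z} → z ∈ Z → c z ∈ img X Z
  ∈img⁺ {Z} {z} z∈Z = ∈-tabulate-does⁺ (Image? Z) (z , z∈Z , refl)

  ∈img⁻ : ∀ {Z x} → x ∈ img X Z → ∃ λ z → z ∈ Z × c z ≡ x
  ∈img⁻ {Z} = ∈-tabulate-does⁻ (Image? Z)

  downClosure : Subset n → Subset n
  downClosure Z = tabulate (does ∘ Down? Z)

  ∈↓⁺ : ∀ {Z x} → Down X Z x → x ∈ downClosure Z
  ∈↓⁺ {Z} = ∈-tabulate-does⁺ (Down? Z)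

  ∈↓⁻ : ∀ {Z x} → x ∈ downClosure Z → Down X Z x
  ∈↓⁻ {Z} = ∈-tabulate-does⁻ (Down? Z)

  downClosure-isDownSet : ∀ Z → IsDownSet X (downClosure Z)
  downClosure-isDownSet Z x y y∈↓Z x≼y with ∈↓⁻ y∈↓Z
  ... | z , z∈Z , y≼z = ∈↓⁺ (z , z∈Z , ≼-trans x≼y y≼z)

  ∁-isUpSet : ∀ {D} → IsDownSet X D → IsUpSet X (∁ D)
  ∁-isUpSet isDown x y x∈∁D x≼y = x∉p⇒x∈∁p (λ y∈D → x∈∁p⇒x∉p x∈∁D (isDown x y y∈D x≼y))

  antichain-⊆ : ∀ {Y Z} → IsAntichain X Z → Y ⊆ Z → IsAntichain X Y
  antichain-⊆ anti Y⊆Z x y x∈Y y∈Y = anti x y (Y⊆Z x∈Y) (Y⊆Z y∈Y)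

  Min-isAntichain : ∀ Z → IsAntichain X (Min X Z)
  Min-isAntichain Z x y x∈Min y∈Min = proj₂ (∈Min⁻ y∈Min) x (proj₁ (∈Min⁻ x∈Min))

  Max-isAntichain : ∀ Z → IsAntichain X (Max X Z)
  Max-isAntichain Z x y x∈Max y∈Max = proj₂ (∈Max⁻ x∈Max) y (proj₁ (∈Max⁻ y∈Max))

  ∃-Max-above : ∀ {Z x} → x ∈ Z → ∃ λ m → m ∈ Max X Z × x ≼ m
  ∃-Max-above {Z} {x} x∈Z = go x (po-noetherian isPartialOrder x) x∈Z
    where
    go : ∀ x → Acc (flip _≺_) x → x ∈ Z → ∃ λ m → m ∈ Max X Z × x ≼ m
    go x (acc rec) x∈Z with any? (λ y → (y ∈? Z) ×-dec (x ≼? y) ×-dec ¬? (x ≟ y))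
    ... | yes (y , y∈Z , x≼y , x≢y) with go y (rec (x≼y , x≢y)) y∈Z
    ...   | m , m∈Max , y≼m = m , m∈Max , ≼-trans x≼y y≼m
    go x (acc rec) x∈Z | no ∄y = x , ∈Max⁺ (x∈Z , maximal) , ≼-refl
      where
      maximal : ∀ y → y ∈ Z → x ≼ y → x ≡ y
      maximal y y∈Z x≼y = decidable-stable (x ≟ y) (λ x≢y → ∄y (y , y∈Z , x≼y , x≢y))

  downSet≡downClosure-Max : ∀ {D} → IsDownSet X D → D ≡ downClosure (Max X D)
  downSet≡downClosure-Max {D} isDown = ⊆-antisym below-Max from-Max
    where
    below-Max : D ⊆ downClosure (Max X D)
    below-Max x∈D = ∈↓⁺ (∃-Max-above x∈D)
    from-Max : downClosure (Max X D) ⊆ D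
    from-Max {x} x∈↓ with ∈↓⁻ x∈↓
    ... | m , m∈Max , x≼m = isDown x m (proj₁ (∈Max⁻ m∈Max)) x≼m

  Max-downClosure-antichain : ∀ {Y} → IsAntichain X Y → Max X (downClosure Y) ≡ Y
  Max-downClosure-antichain {Y} anti = ⊆-antisym Max⊆Y Y⊆Max
    where
    Max⊆Y : Max X (downClosure Y) ⊆ Y
    Max⊆Y x∈Max with ∈Max⁻ x∈Max
    ... | x∈↓ , maximal with ∈↓⁻ x∈↓
    ...   | y , y∈Y , x≼y with maximal y (∈↓⁺ (y , y∈Y , ≼-refl)) x≼y
    ...     | refl = y∈Y
    Y⊆Max : Y ⊆ Max X (downClosure Y)
    Y⊆Max {y} y∈Y = ∈Max⁺ (∈↓⁺ (y , y∈Y , ≼-refl) , maximal)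
      where
      maximal : ∀ w → w ∈ downClosure Y → y ≼ w → y ≡ w
      maximal w w∈↓ y≼w with ∈↓⁻ w∈↓
      ... | z , z∈Y , w≼z with anti y z y∈Y z∈Y (≼-trans y≼w w≼z)
      ...   | refl = ≼-antisym y≼w w≼z

op : ∀ {n} → SIPoset n → SIPoset n
op X = record
  { _≼_ = flip _≼_ ; _≼?_ = flip _≼?_ ; isPartialOrder = Flip.isPartialOrder isPartialOrder
  ; c = c ; c-invol = c-invol ; c-anti = c-anti ; c-nofix = c-nofix }
  where open SIPoset X

Max-op : ∀ {n} (X : SIPoset n) Z → Max (op X) Z ≡ Min X Z
Max-op X Z = ⊆-antisym
  (λ x∈ → let (x∈Z , maximal) = ∈Max⁻ (op X) x∈ in ∈Min⁺ X (x∈Z , λ y y∈Z y≼x → sym (maximal y y∈Z y≼x)))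
  (λ x∈ → let (x∈Z , minimal) = ∈Min⁻ X x∈ in ∈Max⁺ (op X) (x∈Z , λ y y∈Z y≼x → sym (minimal y y∈Z y≼x)))
  where open Order

-- op (op X) has definitionally the order of X, so Max (op (op X)) Z is Max X Z.
Min-op : ∀ {n} (X : SIPoset n) Z → Min (op X) Z ≡ Max X Z
Min-op X Z = sym (Max-op (op X) Z)

∃-Min-below : ∀ {n} (X : SIPoset n) {Z x} → x ∈ Z → ∃ λ m → m ∈ Min X Z × SIPoset._≼_ X m x
∃-Min-below X {Z} {x} x∈Z = subst (λ M → ∃ λ m → m ∈ M × m ≼ x) (Max-op X Z) (Order.∃-Max-above (op X) x∈Z)
  where open SIPoset X using (_≼_)

antichain-op : ∀ {n} (X : SIPoset n) {Z} → IsAntichain X Z → IsAntichain (op X) Z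
antichain-op X anti x y x∈Z y∈Z y≼x = sym (anti y x y∈Z x∈Z y≼x)

module Plus {n : ℕ} (X : SIPoset n) where
  open SIPoset X
  open IsPartialOrder isPartialOrder using () renaming (refl to ≼-refl; trans to ≼-trans; antisym to ≼-antisym)
  open Order X

  boundary+ : Subset n → Basis X
  boundary+ A = (Min X A ∩ ∁ (img X (Max X (∁ A))) , Max X (∁ A))

  h+≡boundary+ : ∀ {A} → img X (∁ A) ⊆ A → h+ X A ≡ boundary+ A
  h+≡boundary+ {A} ∁A↦A = cong₂ _,_ (⊆-antisym P⊆ ⊆P) (⊆-antisym M⊆ ⊆M)
    where
    P⊆ : Core+ X A ∩ A ⊆ Min X A ∩ ∁ (img X (Max X (∁ A)))
    P⊆ x∈ with x∈p∩q⁻ _ A x∈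
    ... | x∈Core , x∈A with x∈p∩q⁻ (NA X A) _ x∈Core
    ...   | x∈NA , x∉img with x∈p∪q⁻ (Min X A) _ x∈NA
    ...     | inj₁ x∈Min = x∈p∩q⁺ (x∈Min , x∉img)
    ...     | inj₂ x∈Max = ⊥-elim (x∈∁p⇒x∉p (proj₁ (∈Max⁻ x∈Max)) x∈A)
    ⊆P : Min X A ∩ ∁ (img X (Max X (∁ A))) ⊆ Core+ X A ∩ A
    ⊆P x∈ with x∈p∩q⁻ (Min X A) _ x∈
    ... | x∈Min , x∉img = x∈p∩q⁺ (x∈p∩q⁺ (x∈p∪q⁺ (inj₁ x∈Min) , x∉img) , proj₁ (∈Min⁻ x∈Min))
    M⊆ : Core+ X A ∩ ∁ A ⊆ Max X (∁ A)
    M⊆ x∈ with x∈p∩q⁻ _ (∁ A) x∈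
    ... | x∈Core , x∈∁A with x∈p∪q⁻ (Min X A) _ (proj₁ (x∈p∩q⁻ (NA X A) _ x∈Core))
    ...   | inj₁ x∈Min = ⊥-elim (x∈∁p⇒x∉p x∈∁A (proj₁ (∈Min⁻ x∈Min)))
    ...   | inj₂ x∈Max = x∈Max
    -- x is no wᶜ with w ∈ Max (∁ A), since such wᶜ lie in A by img (∁ A) ⊆ A.
    ⊆M : Max X (∁ A) ⊆ Core+ X A ∩ ∁ A
    ⊆M {x} x∈Max = x∈p∩q⁺ (x∈p∩q⁺ (x∈p∪q⁺ (inj₂ x∈Max) , x∉p⇒x∈∁p x∉img) , x∈∁A)
      where
      x∈∁A : x ∈ ∁ A
      x∈∁A = proj₁ (∈Max⁻ x∈Max)
      x∉img : x ∉ img X (Max X (∁ A))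
      x∉img x∈img with ∈img⁻ x∈img
      ... | w , w∈Max , refl = x∈∁p⇒x∉p x∈∁A (∁A↦A (∈img⁺ (proj₁ (∈Max⁻ w∈Max))))

  boundary+-isBasis+ : ∀ {A} → IsW+ X A → IsBasis+ X (boundary+ A)
  boundary+-isBasis+ {A} (isUp , ∁isDown , ∁A↦A) =
    antichain-⊆ (Min-isAntichain A) P⊆Min , Max-isAntichain (∁ A) , disjoint , b1 , b2 , b3
    where
    M P : Subset n
    M = Max X (∁ A)
    P = Min X A ∩ ∁ (img X M)
    P⊆Min : P ⊆ Min X A
    P⊆Min = proj₁ ∘ x∈p∩q⁻ _ _
    P⊆A : P ⊆ A
    P⊆A = proj₁ ∘ ∈Min⁻ ∘ P⊆Min
    M⊆∁A : M ⊆ ∁ A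
    M⊆∁A = proj₁ ∘ ∈Max⁻
    imgM⊆A : img X M ⊆ A
    imgM⊆A x∈ with ∈img⁻ x∈
    ... | w , w∈M , refl = ∁A↦A (∈img⁺ (M⊆∁A w∈M))
    disjoint : Disjoint X P M
    disjoint x x∈P x∈M = x∈∁p⇒x∉p (M⊆∁A x∈M) (P⊆A x∈P)
    -- Below z ∈ Min A lies nothing of A other than z, and img M ⊆ A.
    b1 : ∀ x → Down X P x → x ∈ img X M → ⊥
    b1 x (z , z∈P , x≼z) x∈img with x∈p∩q⁻ (Min X A) _ z∈P
    ... | z∈Min , z∉img with proj₂ (∈Min⁻ z∈Min) x (imgM⊆A x∈img) x≼z
    ...   | refl = x∈∁p⇒x∉p z∉img x∈img
    above-⊆A : ∀ x → Up X P x ⊎ Up X (img X M) x → x ∈ A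
    above-⊆A x (inj₁ (z , z∈P , z≼x)) = isUp z x (P⊆A z∈P) z≼x
    above-⊆A x (inj₂ (z , z∈img , z≼x)) = isUp z x (imgM⊆A z∈img) z≼x
    b2 : ∀ x → Up X P x ⊎ Up X (img X M) x → Down X M x → ⊥
    b2 x above (z , z∈M , x≼z) = x∈∁p⇒x∉p (∁isDown x z (M⊆∁A z∈M) x≼z) (above-⊆A x above)
    b3 : ∀ x → (Up X P x ⊎ Up X (img X M) x) ⊎ Down X M x
    b3 x with x ∈? A
    ... | no x∉A = inj₂ (∃-Max-above (x∉p⇒x∈∁p x∉A))
    ... | yes x∈A with ∃-Min-below X x∈A
    ...   | m , m∈Min , m≼x with m ∈? img X M
    ...     | yes m∈img = inj₁ (inj₂ (m , m∈img , m≼x))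
    ...     | no m∉img = inj₁ (inj₁ (m , x∈p∩q⁺ (m∈Min , x∉p⇒x∈∁p m∉img) , m≼x))

  boundary+-injective : ∀ {A B} → IsDownSet X (∁ A) → IsDownSet X (∁ B) → boundary+ A ≡ boundary+ B → A ≡ B
  boundary+-injective {A} {B} ∁A-isDown ∁B-isDown e = ∁-injective (begin
    ∁ A                           ≡⟨ downSet≡downClosure-Max ∁A-isDown ⟩
    downClosure (Max X (∁ A))     ≡⟨ cong (downClosure ∘ proj₂) e ⟩
    downClosure (Max X (∁ B))     ≡⟨ sym (downSet≡downClosure-Max ∁B-isDown) ⟩
    ∁ B                           ∎)
    where open ≡-Reasoning

  module _ {Y₊ Y₋ : Subset n} (isBasis : IsBasis+ X (Y₊ , Y₋)) where
    private
      Y₊-anti : IsAntichain X Y₊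
      Y₊-anti = proj₁ isBasis
      Y₋-anti : IsAntichain X Y₋
      Y₋-anti = proj₁ (proj₂ isBasis)
      b1 : ∀ x → Down X Y₊ x → x ∈ img X Y₋ → ⊥
      b1 = proj₁ (proj₂ (proj₂ (proj₂ isBasis)))
      b2 : ∀ x → Up X Y₊ x ⊎ Up X (img X Y₋) x → Down X Y₋ x → ⊥
      b2 = proj₁ (proj₂ (proj₂ (proj₂ (proj₂ isBasis))))
      b3 : ∀ x → (Up X Y₊ x ⊎ Up X (img X Y₋) x) ⊎ Down X Y₋ x
      b3 = proj₂ (proj₂ (proj₂ (proj₂ (proj₂ isBasis))))

    preimage+ : Subset n
    preimage+ = ∁ (downClosure Y₋)

    ∁preimage+ : ∁ preimage+ ≡ downClosure Y₋
    ∁preimage+ = ∁-involutive (downClosure Y₋)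

    ∈preimage+⁺ : ∀ {x} → Up X Y₊ x ⊎ Up X (img X Y₋) x → x ∈ preimage+
    ∈preimage+⁺ {x} above = x∉p⇒x∈∁p (b2 x above ∘ ∈↓⁻)

    ∈preimage+⁻ : ∀ {x} → x ∈ preimage+ → Up X Y₊ x ⊎ Up X (img X Y₋) x
    ∈preimage+⁻ {x} x∈ with b3 x
    ... | inj₁ above = above
    ... | inj₂ below = ⊥-elim (x∈∁p⇒x∉p x∈ (∈↓⁺ below))

    preimage+-isW+ : IsW+ X preimage+
    preimage+-isW+ = ∁-isUpSet (downClosure-isDownSet Y₋) ,
                     subst (IsDownSet X) (sym ∁preimage+) (downClosure-isDownSet Y₋) ,
                     ∁↦preimage
      where
      ∁↦preimage : img X (∁ preimage+) ⊆ preimage+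
      ∁↦preimage x∈ with ∈img⁻ x∈
      ... | d , d∈∁ , refl with ∈↓⁻ (subst (d ∈_) ∁preimage+ d∈∁)
      ...   | y , y∈Y₋ , d≼y = ∈preimage+⁺ (inj₂ (c y , ∈img⁺ y∈Y₋ , c-anti d≼y))

    Min-preimage+∖img≡Y₊ : Min X preimage+ ∩ ∁ (img X Y₋) ≡ Y₊
    Min-preimage+∖img≡Y₊ = ⊆-antisym ⊆Y₊ Y₊⊆
      where
      ⊆Y₊ : Min X preimage+ ∩ ∁ (img X Y₋) ⊆ Y₊
      ⊆Y₊ {x} x∈ with x∈p∩q⁻ (Min X preimage+) _ x∈
      ... | x∈Min , x∉img with ∈Min⁻ x∈Min
      ...   | x∈U , minimal with ∈preimage+⁻ x∈U
      ...     | inj₁ (z , z∈Y₊ , z≼x) with minimal z (∈preimage+⁺ (inj₁ (z , z∈Y₊ , ≼-refl))) z≼x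
      ...       | refl = z∈Y₊
      ⊆Y₊ {x} x∈ | x∈Min , x∉img | x∈U , minimal | inj₂ (z , z∈img , z≼x)
        with minimal z (∈preimage+⁺ (inj₂ (z , z∈img , ≼-refl))) z≼x
      ...       | refl = ⊥-elim (x∈∁p⇒x∉p x∉img z∈img)
      -- Nothing of img Y₋ lies below y ∈ Y₊ by (B1+), and Y₊ is an antichain.
      Y₊⊆ : Y₊ ⊆ Min X preimage+ ∩ ∁ (img X Y₋)
      Y₊⊆ {y} y∈Y₊ = x∈p∩q⁺ (∈Min⁺ (∈preimage+⁺ (inj₁ (y , y∈Y₊ , ≼-refl)) , minimal) ,
                             x∉p⇒x∈∁p (b1 y (y , y∈Y₊ , ≼-refl)))
        where
        minimal : ∀ w → w ∈ preimage+ → w ≼ y → w ≡ y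
        minimal w w∈U w≼y with ∈preimage+⁻ w∈U
        ... | inj₁ (z , z∈Y₊ , z≼w) with Y₊-anti z y z∈Y₊ y∈Y₊ (≼-trans z≼w w≼y)
        ...   | refl = ≼-antisym w≼y z≼w
        minimal w w∈U w≼y | inj₂ (z , z∈img , z≼w) = ⊥-elim (b1 z (y , y∈Y₊ , ≼-trans z≼w w≼y) z∈img)

    boundary+-preimage+ : boundary+ preimage+ ≡ (Y₊ , Y₋)
    boundary+-preimage+ = begin
      (Min X preimage+ ∩ ∁ (img X (Max X (∁ preimage+))) , Max X (∁ preimage+))
        ≡⟨ cong (λ M → Min X preimage+ ∩ ∁ (img X M) , M) Max∁≡Y₋ ⟩
      (Min X preimage+ ∩ ∁ (img X Y₋) , Y₋)
        ≡⟨ cong (_, Y₋) Min-preimage+∖img≡Y₊ ⟩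
      (Y₊ , Y₋) ∎
      where
      open ≡-Reasoning
      Max∁≡Y₋ : Max X (∁ preimage+) ≡ Y₋
      Max∁≡Y₋ = trans (cong (Max X) ∁preimage+) (Max-downClosure-antichain Y₋-anti)

  wellDefBij-h+ : WellDefBij (IsW+ X) (IsBasis+ X) (h+ X)
  wellDefBij-h+ = wd , inj , surj
    where
    wd : ∀ A → IsW+ X A → IsBasis+ X (h+ X A)
    wd A w@(_ , _ , ∁A↦A) = subst (IsBasis+ X) (sym (h+≡boundary+ ∁A↦A)) (boundary+-isBasis+ w)
    inj : ∀ A B → IsW+ X A → IsW+ X B → h+ X A ≡ h+ X B → A ≡ B
    inj A B (_ , ∁A-isDown , ∁A↦A) (_ , ∁B-isDown , ∁B↦B) e = boundary+-injective ∁A-isDown ∁B-isDown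
      (trans (sym (h+≡boundary+ ∁A↦A)) (trans e (h+≡boundary+ ∁B↦B)))
    surj : ∀ t → IsBasis+ X t → Σ (Subset n) λ A → IsW+ X A × h+ X A ≡ t
    surj (_ , _) isBasis = preimage+ isBasis , preimage+-isW+ isBasis ,
      trans (h+≡boundary+ (proj₂ (proj₂ (preimage+-isW+ isBasis)))) (boundary+-preimage+ isBasis)

module Minus {n : ℕ} (X : SIPoset n) where

  Core+-op : ∀ A → Core+ (op X) (∁ A) ≡ Core- X A
  Core+-op A rewrite ∁-involutive A | Max-op X A | Min-op X (∁ A) =
    cong (_∩ ∁ (img X (Min X A))) (∪-comm (Max X (∁ A)) (Min X A))

  h+-op : ∀ A → h+ (op X) (∁ A) ≡ swap (h- X A)
  h+-op A rewrite Core+-op A | ∁-involutive A = refl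

  W-⇒W+-op : ∀ A → IsW- X A → IsW+ (op X) (∁ A)
  W-⇒W+-op A (isUp , ∁isDown , A↦∁A) rewrite ∁-involutive A =
    (λ x y x∈ y≼x → ∁isDown y x x∈ y≼x) , (λ x y y∈ x≼y → isUp y x y∈ x≼y) , A↦∁A

  W+-op⇒W- : ∀ A → IsW+ (op X) A → IsW- X (∁ A)
  W+-op⇒W- A (isUp , ∁isDown , ∁A↦A) rewrite ∁-involutive A =
    (λ x y x∈ x≼y → ∁isDown y x x∈ x≼y) , (λ x y y∈ x≼y → isUp y x y∈ x≼y) , ∁A↦A

  Basis-⇒Basis+-op : ∀ t → IsBasis- X t → IsBasis+ (op X) (swap t)
  Basis-⇒Basis+-op (_ , _) (Y₊-anti , Y₋-anti , disjoint , b1 , b2 , b3) =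
    antichain-op X Y₋-anti , antichain-op X Y₊-anti , (λ x x∈Y₋ x∈Y₊ → disjoint x x∈Y₊ x∈Y₋) , b1 , b2 , b3

  Basis+-op⇒Basis- : ∀ t → IsBasis+ (op X) t → IsBasis- X (swap t)
  Basis+-op⇒Basis- (_ , _) (Y₊-anti , Y₋-anti , disjoint , b1 , b2 , b3) =
    antichain-op (op X) Y₋-anti , antichain-op (op X) Y₊-anti , (λ x x∈Y₋ x∈Y₊ → disjoint x x∈Y₊ x∈Y₋) , b1 , b2 , b3

  wellDefBij-h- : WellDefBij (IsW- X) (IsBasis- X) (h- X)
  wellDefBij-h- = WellDefBij-transport ∁ swap ∁-involutive (λ _ → refl)
    W-⇒W+-op W+-op⇒W- Basis-⇒Basis+-op Basis+-op⇒Basis- h+-op (Plus.wellDefBij-h+ (op X))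

theorem4p4 : ∀ (n : ℕ) (X : SIPoset n)
    → WellDefBij (IsW+ X) (IsBasis+ X) (h+ X) × WellDefBij (IsW- X) (IsBasis- X) (h- X)
theorem4p4 n X = Plus.wellDefBij-h+ X , Minus.wellDefBij-h- X
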